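{- For every $n\ge 0$, $$a_n:=\sum_{k\ge 0}\frac{(2k)!}{k!\,2^k}\binom{n+1}{2k+1}=\sum_{j=0}^{n} I_1(j).$$
   Context: For $n\ge 0$, $I_1(n)$ denotes the number of involutions in the symmetric group $\mathfrak{S}_n$, i.e. permutations $\pi$ with $\pi^2=\mathrm{id}$ (with $I_1(0)=1$). -}

module Defs where

open import Data.Nat using (ℕ; zero; suc; _+_; _*_; _^_; _/_; _!)
open import Data.Nat.Combinatorics using (_C_)
open import Data.Nat.Properties using (m*n≢0; m^n≢0; _!≢0)
open import Data.Fin using (Fin; zero; suc)
open import Data.Fin.Properties using (_≟_; all?)
open import Data.List using (List; []; _∷_; map; concatMap; filter; length; allFin; upTo)
open import Data.Product using (_×_)
open import Data.Product.Properties using ()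
open import Relation.Nullary using (Dec; _×-dec_)
open import Relation.Binary.PropositionalEquality using (_≡_)
open import Relation.Nullary.Decidable using (¬?)
open import Relation.Nullary.Decidable using (_→-dec_)

allFuns : (m n : ℕ) → List (Fin m → Fin n)
allFuns zero n = (λ ()) ∷ []
allFuns (suc m) n =
  concatMap (λ x → map (λ f → λ { zero → x ; (suc i) → f i }) (allFuns m n)) (allFin n)

-- A self-map π of Fin n is a permutation iff it is injective (finite set);
IsPerm : ∀ {n} → (Fin n → Fin n) → Set
IsPerm {n} π = ∀ i j → π i ≡ π j → i ≡ j

IsInvol : ∀ {n} → (Fin n → Fin n) → Set
IsInvol {n} π = ∀ i → π (π i) ≡ i

isPerm? : ∀ {n} (π : Fin n → Fin n) → Dec (IsPerm π)
isPerm? {n} π = all? λ i → all? λ j → (π i ≟ π j) →-dec (i ≟ j)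

isInvol? : ∀ {n} (π : Fin n → Fin n) → Dec (IsInvol π)
isInvol? {n} π = all? λ i → π (π i) ≟ i

I₁ : ℕ → ℕ
I₁ n = length (filter (λ π → isPerm? π ×-dec isInvol? π) (allFuns n n))

-- (2k)! / (k! 2^k)   (an integer; ℕ division)
oddDoubleFact : ℕ → ℕ
oddDoubleFact k = ((2 * k) !) / (k ! * 2 ^ k)
  where
  instance
    nz1 = k !≢0
    nz2 = m^n≢0 2 k
    nz = m*n≢0 (k !) (2 ^ k)

-- Splitting involutions of {0, …, n+1} by whether 0 is fixed or swapped with one of the
-- other n+1 points gives I₁(n+2) = I₁(n+1) + (n+1) I₁(n).  The closed form
-- I₁(j) = Σ_k (2k−1)!! C(j,2k) (choose the 2k moved points, then pair them up) satisfies
-- the same recurrence by Pascal's rule and the absorption identity.  Summing it over j ≤ n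
-- and using the hockey-stick identity Σ_{j≤n} C(j,2k) = C(n+1,2k+1) gives the theorem.
-- Involutions are counted as a sum of 0/1 weights over all maps Fin m → Fin n, split by
-- the value at one point and by excluding a value that the weight forbids.

module Submission where

open import Defs
open import Data.Nat using (ℕ; zero; suc; _+_; _*_; _^_; _/_; _!; _≤_; z≤n; s≤s)
open import Data.Nat.Properties
  using (+-*-semiring; +-comm; +-assoc; +-identityʳ; *-suc; *-zeroʳ; *-identityʳ; *-distribˡ-+; *-monoʳ-≤
        ; ≤-trans; ≤-pred; n≤1+n; m≤m+n; <-≤-trans; _!≢0; m^n≢0; m*n≢0)
open import Data.Nat.Combinatorics using (_C_; nCk+nC[k+1]≡[n+1]C[k+1]; k>n⇒nCk≡0; nC1≡n)
open import Data.Nat.DivMod using (m*n/n≡m)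
open import Data.Nat.Tactic.RingSolver using (solve-∀)
open import Data.Nat.ListAction using (sum)
open import Data.Nat.ListAction.Properties using (sum-++)
open import Data.Fin using (Fin; zero; suc; toℕ; punchIn; punchOut)
open import Data.Fin.Properties
  using (punchInᵢ≢i; punchIn-injective; punchIn-punchOut; suc-injective; 0≢1+n; _≟_
        ; toℕ-inject₁; toℕ-fromℕ; toℕ<n)
open import Data.List as List
  using (List; []; map; concatMap; filter; length; allFin; tabulate; applyUpTo; upTo; _++_)
open import Data.List.Properties using (map-++; map-cong; map-∘)
open import Data.Vec.Functional using (_∷_; insertAt)
open import Data.Vec.Functional.Properties using (insertAt-lookup; insertAt-punchIn)
open import Data.Product using (_,_; proj₂)
open import Function using (_∘_; _⇔_; mk⇔; Equivalence)
open import Relation.Binary.Core using (_Preserves_⟶_)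
open import Relation.Nullary using (Dec; yes; no; ¬_; _×-dec_; contradiction)
open import Relation.Binary.PropositionalEquality
open import Algebra.Properties.Semiring.Sum +-*-semiring
  using (sum-syntax; sum-cong-≗; sum-remove; sum-init-last; sum-replicate-zero
        ; ∑-distrib-+; ∑-comm; *-distribˡ-sum)

∑-const : ∀ n c → ∑[ i < n ] c ≡ n * c
∑-const zero c = refl
∑-const (suc n) c = cong (c +_) (∑-const n c)

∑-zero : ∀ {n} (f : Fin n → ℕ) → (∀ i → f i ≡ 0) → ∑[ i < n ] f i ≡ 0
∑-zero {n} f f≗0 = trans (sum-cong-≗ f≗0) (sum-replicate-zero n)

∑-toℕ-snoc : ∀ (f : ℕ → ℕ) n → ∑[ i < suc n ] f (toℕ i) ≡ ∑[ i < n ] f (toℕ i) + f n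
∑-toℕ-snoc f n = trans (sum-init-last {n} (f ∘ toℕ))
  (cong₂ _+_ (sum-cong-≗ {n} (λ i → cong f (toℕ-inject₁ i))) (cong f (toℕ-fromℕ n)))

sum-map-applyUpTo : ∀ (f g : ℕ → ℕ) n → sum (map f (applyUpTo g n)) ≡ ∑[ i < n ] f (g (toℕ i))
sum-map-applyUpTo f g zero = refl
sum-map-applyUpTo f g (suc n) = cong (f (g 0) +_) (sum-map-applyUpTo f (g ∘ suc) n)

sum-map-tabulate : ∀ {A : Set} {n} (f : A → ℕ) (g : Fin n → A) →
  sum (map f (tabulate g)) ≡ ∑[ i < n ] f (g i)
sum-map-tabulate {n = zero} f g = refl
sum-map-tabulate {n = suc n} f g = cong (f (g zero) +_) (sum-map-tabulate f (g ∘ suc))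

sum-map-concatMap : ∀ {A B : Set} (w : B → ℕ) (g : A → List B) xs →
  sum (map w (concatMap g xs)) ≡ sum (map (sum ∘ map w ∘ g) xs)
sum-map-concatMap w g [] = refl
sum-map-concatMap w g (x List.∷ xs) = begin
  sum (map w (g x ++ concatMap g xs))                  ≡⟨ cong sum (map-++ w (g x) _) ⟩
  sum (map w (g x) ++ map w (concatMap g xs))          ≡⟨ sum-++ (map w (g x)) _ ⟩
  sum (map w (g x)) + sum (map w (concatMap g xs))     ≡⟨ cong (sum (map w (g x)) +_) (sum-map-concatMap w g xs) ⟩
  sum (map w (g x)) + sum (map (sum ∘ map w ∘ g) xs)   ∎
  where open ≡-Reasoning

indicator : ∀ {P : Set} → Dec P → ℕ
indicator (yes _) = 1
indicator (no _) = 0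

indicator-cong : ∀ {P Q : Set} → P ⇔ Q → (P? : Dec P) (Q? : Dec Q) → indicator P? ≡ indicator Q?
indicator-cong P⇔Q (yes _) (yes _) = refl
indicator-cong P⇔Q (yes p) (no ¬q) = contradiction (Equivalence.to P⇔Q p) ¬q
indicator-cong P⇔Q (no ¬p) (yes q) = contradiction (Equivalence.from P⇔Q q) ¬p
indicator-cong P⇔Q (no _) (no _) = refl

indicator-no : ∀ {P : Set} → ¬ P → (P? : Dec P) → indicator P? ≡ 0
indicator-no ¬p (yes p) = contradiction p ¬p
indicator-no ¬p (no _) = refl

length-filter≡sum-indicator : ∀ {A : Set} {P : A → Set} (P? : ∀ x → Dec (P x)) xs →
  length (filter P? xs) ≡ sum (map (indicator ∘ P?) xs)
length-filter≡sum-indicator P? [] = refl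
length-filter≡sum-indicator P? (x List.∷ xs) with P? x
... | yes _ = cong suc (length-filter≡sum-indicator P? xs)
... | no _ = length-filter≡sum-indicator P? xs

∷-congʳ : ∀ {A : Set} {n} (x : A) {f g : Fin n → A} → f ≗ g → (x ∷ f) ≗ (x ∷ g)
∷-congʳ x f≗g zero = refl
∷-congʳ x f≗g (suc i) = f≗g i

∘-∷ : ∀ {A B : Set} {n} (g : A → B) x (h : Fin n → A) → g ∘ (x ∷ h) ≗ g x ∷ g ∘ h
∘-∷ g x h zero = refl
∘-∷ g x h (suc i) = refl

insertAt-zero : ∀ {A : Set} {n} (f : Fin n → A) x → insertAt f zero x ≗ x ∷ f
insertAt-zero f x zero = refl
insertAt-zero f x (suc i) = refl

insertAt-suc : ∀ {A : Set} {n} y (f : Fin n → A) j x → insertAt (y ∷ f) (suc j) x ≗ y ∷ insertAt f j x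
insertAt-suc y f j x zero = refl
insertAt-suc y f j x (suc i) = refl

insertAt-cong : ∀ {A : Set} {n} {f g : Fin n → A} → f ≗ g → ∀ j x → insertAt f j x ≗ insertAt g j x
insertAt-cong f≗g zero x zero = refl
insertAt-cong f≗g zero x (suc i) = f≗g i
insertAt-cong {n = suc n} f≗g (suc j) x zero = f≗g zero
insertAt-cong {n = suc n} f≗g (suc j) x (suc i) = insertAt-cong (f≗g ∘ suc) j x i

sumOverMaps : ∀ m n → ((Fin m → Fin n) → ℕ) → ℕ
sumOverMaps zero n w = w (λ ())
sumOverMaps (suc m) n w = ∑[ x < n ] sumOverMaps m n (λ f → w (x ∷ f))

sumOverMaps-cong : ∀ {m n} {w v : (Fin m → Fin n) → ℕ} → w ≗ v → sumOverMaps m n w ≡ sumOverMaps m n v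
sumOverMaps-cong {zero} w≗v = w≗v _
sumOverMaps-cong {suc m} w≗v = sum-cong-≗ (λ x → sumOverMaps-cong (λ f → w≗v (x ∷ f)))

sumOverMaps-zero : ∀ {m n} {w : (Fin m → Fin n) → ℕ} → (∀ f → w f ≡ 0) → sumOverMaps m n w ≡ 0
sumOverMaps-zero {zero} w≡0 = w≡0 _
sumOverMaps-zero {suc m} w≡0 = ∑-zero _ (λ x → sumOverMaps-zero (λ f → w≡0 (x ∷ f)))

sum-allFuns : ∀ m n (w : (Fin m → Fin n) → ℕ) → w Preserves _≗_ ⟶ _≡_ →
  sum (map w (allFuns m n)) ≡ sumOverMaps m n w
sum-allFuns zero n w w-ext = +-identityʳ _
sum-allFuns (suc m) n w w-ext =
  trans (sum-map-concatMap w _ (allFin n))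
    (trans (cong sum (map-cong (λ x → sum-map-extension x _ (λ f → λ { zero → refl ; (suc i) → refl })) (allFin n)))
      (sum-map-tabulate (λ x → sumOverMaps m n (λ f → w (x ∷ f))) (λ x → x)))
  where
  -- allFuns extends f by a pattern-matching lambda, equal to x ∷ f only pointwise;
  -- this is why the weights are required to respect _≗_.
  sum-map-extension : ∀ x (e : (Fin m → Fin n) → Fin (suc m) → Fin n) → (∀ f → e f ≗ x ∷ f) →
    sum (map w (map e (allFuns m n))) ≡ sumOverMaps m n (λ f → w (x ∷ f))
  sum-map-extension x e e≗x∷ = begin
    sum (map w (map e (allFuns m n)))
      ≡⟨ cong sum (map-∘ (allFuns m n)) ⟨
    sum (map (w ∘ e) (allFuns m n))
      ≡⟨ cong sum (map-cong (λ f → w-ext (e≗x∷ f)) (allFuns m n)) ⟩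
    sum (map (λ f → w (x ∷ f)) (allFuns m n))
      ≡⟨ sum-allFuns m n (λ f → w (x ∷ f)) (w-ext ∘ ∷-congʳ x) ⟩
    sumOverMaps m n (λ f → w (x ∷ f))
      ∎
    where open ≡-Reasoning

sumOverMaps-avoiding : ∀ {m N} (a : Fin (suc N)) (w : (Fin m → Fin (suc N)) → ℕ) →
  w Preserves _≗_ ⟶ _≡_ →
  (∀ f i → f i ≡ a → w f ≡ 0) → sumOverMaps m (suc N) w ≡ sumOverMaps m N (λ h → w (punchIn a ∘ h))
sumOverMaps-avoiding {zero} a w w-ext w-hits = w-ext (λ ())
sumOverMaps-avoiding {suc m} {N} a w w-ext w-hits = begin
  ∑[ x < suc N ] sumOverMaps m (suc N) (λ f → w (x ∷ f))
    ≡⟨ sum-remove {i = a} (λ x → sumOverMaps m (suc N) (λ f → w (x ∷ f))) ⟩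
  sumOverMaps m (suc N) (λ f → w (a ∷ f)) + ∑[ y < N ] sumOverMaps m (suc N) (λ f → w (punchIn a y ∷ f))
    ≡⟨ cong₂ _+_ (sumOverMaps-zero (λ f → w-hits (a ∷ f) zero refl))
                 (sum-cong-≗ {N} (λ y → sumOverMaps-avoiding a _ (w-ext ∘ ∷-congʳ (punchIn a y))
                                                           (λ f i fi≡a → w-hits _ (suc i) fi≡a))) ⟩
  0 + ∑[ y < N ] sumOverMaps m N (λ h → w (punchIn a y ∷ punchIn a ∘ h))
    ≡⟨ sum-cong-≗ {N} (λ y → sumOverMaps-cong (λ h → w-ext (sym ∘ ∘-∷ (punchIn a) y h))) ⟩
  ∑[ y < N ] sumOverMaps m N (λ h → w (punchIn a ∘ (y ∷ h)))  ∎
  where open ≡-Reasoning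

sumOverMaps-insertAt : ∀ {m n} (j : Fin (suc m)) (w : (Fin (suc m) → Fin n) → ℕ) →
  w Preserves _≗_ ⟶ _≡_ →
  sumOverMaps (suc m) n w ≡ ∑[ x < n ] sumOverMaps m n (λ f → w (insertAt f j x))
sumOverMaps-insertAt {n = n} zero w w-ext =
  sum-cong-≗ {n} (λ x → sumOverMaps-cong (λ f → w-ext (sym ∘ insertAt-zero f x)))
sumOverMaps-insertAt {suc m} {n} (suc j) w w-ext = begin
  ∑[ y < n ] sumOverMaps (suc m) n (λ f → w (y ∷ f))
    ≡⟨ sum-cong-≗ {n} (λ y → sumOverMaps-insertAt j _ (w-ext ∘ ∷-congʳ y)) ⟩
  ∑[ y < n ] ∑[ x < n ] sumOverMaps m n (λ f → w (y ∷ insertAt f j x))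
    ≡⟨ ∑-comm (λ y x → sumOverMaps m n (λ f → w (y ∷ insertAt f j x))) ⟩
  ∑[ x < n ] ∑[ y < n ] sumOverMaps m n (λ f → w (y ∷ insertAt f j x))
    ≡⟨ sum-cong-≗ {n} (λ x → sum-cong-≗ {n} (λ y →
         sumOverMaps-cong (λ f → w-ext (sym ∘ insertAt-suc y f j x)))) ⟩
  ∑[ x < n ] sumOverMaps (suc m) n (λ f → w (insertAt f (suc j) x))
    ∎
  where open ≡-Reasoning

involutionIndicator : ∀ {n} → (Fin n → Fin n) → ℕ
involutionIndicator π = indicator (isInvol? π)

involutions : ℕ → ℕ
involutions n = sumOverMaps n n involutionIndicator

IsInvol⇒IsPerm : ∀ {n} {π : Fin n → Fin n} → IsInvol π → IsPerm π
IsInvol⇒IsPerm {π = π} inv i j πi≡πj = trans (sym (inv i)) (trans (cong π πi≡πj) (inv j))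

IsInvol-resp-≗ : ∀ {n} {π σ : Fin n → Fin n} → π ≗ σ → IsInvol π → IsInvol σ
IsInvol-resp-≗ {π = π} {σ} π≗σ inv i = trans (cong σ (sym (π≗σ i))) (trans (sym (π≗σ (π i))) (inv i))

involutionIndicator-cong : ∀ {n} → involutionIndicator {n} Preserves _≗_ ⟶ _≡_
involutionIndicator-cong {x = π} {σ} π≗σ =
  indicator-cong (mk⇔ (IsInvol-resp-≗ π≗σ) (IsInvol-resp-≗ (sym ∘ π≗σ))) (isInvol? π) (isInvol? σ)

I₁≡involutions : ∀ n → I₁ n ≡ involutions n
I₁≡involutions n = begin
  I₁ n
    ≡⟨ length-filter≡sum-indicator isPermInvol? (allFuns n n) ⟩
  sum (map (indicator ∘ isPermInvol?) (allFuns n n))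
    ≡⟨ cong sum (map-cong permInvol≡involutionIndicator (allFuns n n)) ⟩
  sum (map involutionIndicator (allFuns n n))
    ≡⟨ sum-allFuns n n involutionIndicator involutionIndicator-cong ⟩
  involutions n
    ∎
  where
  open ≡-Reasoning
  isPermInvol? = λ (π : Fin n → Fin n) → isPerm? π ×-dec isInvol? π
  permInvol≡involutionIndicator : ∀ π → indicator (isPermInvol? π) ≡ involutionIndicator π
  permInvol≡involutionIndicator π = indicator-cong (mk⇔ proj₂ (λ inv → IsInvol⇒IsPerm inv , inv)) _ _

involutionIndicator≡0 : ∀ {n} {π : Fin n → Fin n} → ¬ IsInvol π → involutionIndicator π ≡ 0
involutionIndicator≡0 {π = π} ¬inv = indicator-no ¬inv (isInvol? π)

fixZero : ∀ {n} → (Fin n → Fin n) → Fin (suc n) → Fin (suc n)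
fixZero h = zero ∷ suc ∘ h

IsInvol-fixZero : ∀ {n} (h : Fin n → Fin n) → IsInvol (fixZero h) ⇔ IsInvol h
IsInvol-fixZero h = mk⇔ (λ inv i → suc-injective (inv (suc i))) from
  where
  from : IsInvol h → IsInvol (fixZero h)
  from inv zero = refl
  from inv (suc i) = cong suc (inv i)

involutions-fixing-zero : ∀ n → sumOverMaps n (suc n) (λ g → involutionIndicator (zero ∷ g)) ≡ involutions n
involutions-fixing-zero n =
  trans (sumOverMaps-avoiding zero _ (involutionIndicator-cong ∘ ∷-congʳ zero) hits-zero)
    (sumOverMaps-cong {n} (λ h → indicator-cong (IsInvol-fixZero h) (isInvol? (fixZero h)) (isInvol? h)))
  where
  hits-zero : ∀ (g : Fin n → Fin (suc n)) i → g i ≡ zero → involutionIndicator (zero ∷ g) ≡ 0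
  hits-zero g i gi≡0 = involutionIndicator≡0 {π = zero ∷ g}
    (λ inv → 0≢1+n (trans (sym (cong (zero ∷ g) gi≡0)) (inv (suc i))))

-- Sends 0 ↔ suc j and acts as k on the remaining points, which are the suc (punchIn j i).
swapZero : ∀ {n} → Fin (suc n) → (Fin n → Fin n) → Fin (suc (suc n)) → Fin (suc (suc n))
swapZero j k = suc j ∷ insertAt (suc ∘ punchIn j ∘ k) j zero

module _ {n} (j : Fin (suc n)) (k : Fin n → Fin n) where

  private
    π = swapZero j k
    outside : Fin n → Fin (suc (suc n))
    outside i = suc (punchIn j i)

    π-suc-j : π (suc j) ≡ zero
    π-suc-j = insertAt-lookup (suc ∘ punchIn j ∘ k) j zero

    π-outside : ∀ i → π (outside i) ≡ outside (k i)
    π-outside = insertAt-punchIn (suc ∘ punchIn j ∘ k) j zero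

    π²-outside : ∀ i → π (π (outside i)) ≡ outside (k (k i))
    π²-outside i = trans (cong π (π-outside i)) (π-outside (k i))

  IsInvol-swapZero : IsInvol (swapZero j k) ⇔ IsInvol k
  IsInvol-swapZero = mk⇔ to from
    where
    to : IsInvol π → IsInvol k
    to inv i = punchIn-injective j _ _ (suc-injective (trans (sym (π²-outside i)) (inv (outside i))))

    from : IsInvol k → IsInvol π
    from inv zero = π-suc-j
    from inv (suc y) with j ≟ y
    ... | yes refl = cong π π-suc-j
    ... | no j≢y = subst (λ y → π (π (suc y)) ≡ suc y) (punchIn-punchOut j≢y)
                         (trans (π²-outside i) (cong outside (inv i)))
      where i = punchOut j≢y

involutions-swapping-zero : ∀ n (j : Fin (suc n)) →
  sumOverMaps (suc n) (suc (suc n)) (λ g → involutionIndicator (suc j ∷ g)) ≡ involutions n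
involutions-swapping-zero n j = begin
  sumOverMaps (suc n) (suc (suc n)) (λ g → involutionIndicator (suc j ∷ g))
    ≡⟨ sumOverMaps-insertAt j _ (involutionIndicator-cong ∘ ∷-congʳ (suc j)) ⟩
  sumOverMaps n (suc (suc n)) (ω zero) + ∑[ z < suc n ] sumOverMaps n (suc (suc n)) (ω (suc z))
    ≡⟨ cong (sumOverMaps n (suc (suc n)) (ω zero) +_)
            (∑-zero {suc n} _ (λ z → sumOverMaps-zero (ω-suc z))) ⟩
  sumOverMaps n (suc (suc n)) (ω zero) + 0
    ≡⟨ +-identityʳ _ ⟩
  sumOverMaps n (suc (suc n)) (ω zero)
    ≡⟨ sumOverMaps-avoiding zero (ω zero) (ω-cong zero) ω-hits-zero ⟩
  sumOverMaps n (suc n) (λ h → ω zero (suc ∘ h))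
    ≡⟨ sumOverMaps-avoiding j _ (ω-cong zero ∘ (cong suc ∘_)) ω-hits-j ⟩
  sumOverMaps n n (λ k → involutionIndicator (swapZero j k))
    ≡⟨ sumOverMaps-cong {n} (λ k →
         indicator-cong (IsInvol-swapZero j k) (isInvol? (swapZero j k)) (isInvol? k)) ⟩
  involutions n
    ∎
  where
  open ≡-Reasoning
  ω : Fin (suc (suc n)) → (Fin n → Fin (suc (suc n))) → ℕ
  ω z f = involutionIndicator (suc j ∷ insertAt f j z)

  ω-cong : ∀ z → ω z Preserves _≗_ ⟶ _≡_
  ω-cong z f≗g = involutionIndicator-cong (∷-congʳ (suc j) (insertAt-cong f≗g j z))

  ω-suc : ∀ z f → ω (suc z) f ≡ 0
  ω-suc z f = involutionIndicator≡0 {π = suc j ∷ insertAt f j (suc z)}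
    (λ inv → 0≢1+n (trans (sym (inv zero)) (insertAt-lookup f j (suc z))))

  ω-hits-zero : ∀ f i → f i ≡ zero → ω zero f ≡ 0
  ω-hits-zero f i fi≡0 = involutionIndicator≡0 {π = π} (λ inv → punchInᵢ≢i j i (sym (suc-injective (begin
      suc j                           ≡⟨ cong π (trans (insertAt-punchIn f j zero i) fi≡0) ⟨
      π (π (suc (punchIn j i)))       ≡⟨ inv (suc (punchIn j i)) ⟩
      suc (punchIn j i)               ∎))))
    where π = suc j ∷ insertAt f j zero

  ω-hits-j : ∀ h i → h i ≡ j → ω zero (suc ∘ h) ≡ 0
  ω-hits-j h i hi≡j = involutionIndicator≡0 {π = π} (λ inv → 0≢1+n (begin
      zero                            ≡⟨ insertAt-lookup (suc ∘ h) j zero ⟨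
      π (suc j)                       ≡⟨ cong π (trans (insertAt-punchIn (suc ∘ h) j zero i) (cong suc hi≡j)) ⟨
      π (π (suc (punchIn j i)))       ≡⟨ inv (suc (punchIn j i)) ⟩
      suc (punchIn j i)               ∎))
    where π = suc j ∷ insertAt (suc ∘ h) j zero

involutions-suc-suc : ∀ n → involutions (suc (suc n)) ≡ involutions (suc n) + suc n * involutions n
involutions-suc-suc n = cong₂ _+_ (involutions-fixing-zero (suc n))
  (trans (sum-cong-≗ {suc n} (involutions-swapping-zero n)) (∑-const (suc n) (involutions n)))

I₁-suc-suc : ∀ n → I₁ (suc (suc n)) ≡ I₁ (suc n) + suc n * I₁ n
I₁-suc-suc n = begin
  I₁ (suc (suc n))                             ≡⟨ I₁≡involutions (suc (suc n)) ⟩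
  involutions (suc (suc n))                    ≡⟨ involutions-suc-suc n ⟩
  involutions (suc n) + suc n * involutions n
    ≡⟨ cong₂ (λ a b → a + suc n * b) (I₁≡involutions (suc n)) (I₁≡involutions n) ⟨
  I₁ (suc n) + suc n * I₁ n                    ∎
  where open ≡-Reasoning

nC[1+k]≡∑jCk : ∀ n k → n C suc k ≡ ∑[ j < n ] (toℕ j C k)
nC[1+k]≡∑jCk zero k = refl
nC[1+k]≡∑jCk (suc n) k = begin
  suc n C suc k                      ≡⟨ nCk+nC[k+1]≡[n+1]C[k+1] n k ⟨
  n C k + n C suc k                  ≡⟨ +-comm (n C k) _ ⟩
  n C suc k + n C k                  ≡⟨ cong (_+ n C k) (nC[1+k]≡∑jCk n k) ⟩
  ∑[ j < n ] (toℕ j C k) + n C k     ≡⟨ ∑-toℕ-snoc (_C k) n ⟨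
  ∑[ j < suc n ] (toℕ j C k)         ∎
  where open ≡-Reasoning

[1+k]*[1+n]C[1+k]≡[1+n]*nCk : ∀ n k → suc k * (suc n C suc k) ≡ suc n * (n C k)
[1+k]*[1+n]C[1+k]≡[1+n]*nCk zero zero = refl
[1+k]*[1+n]C[1+k]≡[1+n]*nCk zero (suc k) = begin
  suc (suc k) * (1 C suc (suc k))  ≡⟨ cong (suc (suc k) *_) (k>n⇒nCk≡0 {1} {suc (suc k)} (s≤s (s≤s z≤n))) ⟩
  suc (suc k) * 0                  ≡⟨ *-zeroʳ (suc (suc k)) ⟩
  0                                ≡⟨ cong (1 *_) (k>n⇒nCk≡0 {0} {suc k} (s≤s z≤n)) ⟨
  1 * (0 C suc k)                  ∎
  where open ≡-Reasoning
[1+k]*[1+n]C[1+k]≡[1+n]*nCk (suc n) zero =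
  trans (+-identityʳ _) (trans (nC1≡n (suc (suc n))) (sym (*-identityʳ (suc (suc n)))))
[1+k]*[1+n]C[1+k]≡[1+n]*nCk (suc n) (suc k) = begin
  suc (suc k) * (suc (suc n) C suc (suc k))  ≡⟨ cong (suc (suc k) *_) (nCk+nC[k+1]≡[n+1]C[k+1] (suc n) (suc k)) ⟨
  suc (suc k) * (a + b)                      ≡⟨ distribute a b k ⟩
  a + (suc k * a + suc (suc k) * b)          ≡⟨ cong₂ (λ x y → a + (x + y)) ([1+k]*[1+n]C[1+k]≡[1+n]*nCk n k)
                                                                        ([1+k]*[1+n]C[1+k]≡[1+n]*nCk n (suc k)) ⟩
  a + (suc n * (n C k) + suc n * (n C suc k)) ≡⟨ cong (a +_) (*-distribˡ-+ (suc n) (n C k) (n C suc k)) ⟨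
  a + suc n * (n C k + n C suc k)            ≡⟨ cong (λ x → a + suc n * x) (nCk+nC[k+1]≡[n+1]C[k+1] n k) ⟩
  a + suc n * a                              ∎
  where
  open ≡-Reasoning
  a = suc n C suc k
  b = suc n C suc (suc k)
  distribute : ∀ a b k → suc (suc k) * (a + b) ≡ a + (suc k * a + suc (suc k) * b)
  distribute = solve-∀

matchings : ℕ → ℕ
matchings zero = 1
matchings (suc k) = suc (2 * k) * matchings k

2*[1+k]≡2+2*k : ∀ k → 2 * suc k ≡ suc (suc (2 * k))
2*[1+k]≡2+2*k k = *-suc 2 k

matchings*k!*2^k≡[2k]! : ∀ k → matchings k * (k ! * 2 ^ k) ≡ (2 * k) !
matchings*k!*2^k≡[2k]! zero = refl
matchings*k!*2^k≡[2k]! (suc k) = begin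
  suc (2 * k) * matchings k * (suc k * k ! * (2 * 2 ^ k))   ≡⟨ regroup (matchings k) (k !) (2 ^ k) k ⟩
  suc (suc (2 * k)) * (suc (2 * k) * (matchings k * (k ! * 2 ^ k)))
    ≡⟨ cong (λ x → suc (suc (2 * k)) * (suc (2 * k) * x)) (matchings*k!*2^k≡[2k]! k) ⟩
  suc (suc (2 * k)) * (suc (2 * k) * (2 * k) !)             ≡⟨ cong _! (2*[1+k]≡2+2*k k) ⟨
  (2 * suc k) !                                             ∎
  where
  open ≡-Reasoning
  regroup : ∀ a b c k →
    suc (2 * k) * a * (suc k * b * (2 * c)) ≡ suc (suc (2 * k)) * (suc (2 * k) * (a * (b * c)))
  regroup = solve-∀

oddDoubleFact≡matchings : ∀ k → oddDoubleFact k ≡ matchings k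
oddDoubleFact≡matchings k = begin
  ((2 * k) !) / (k ! * 2 ^ k)                    ≡⟨ cong (_/ (k ! * 2 ^ k)) (matchings*k!*2^k≡[2k]! k) ⟨
  (matchings k * (k ! * 2 ^ k)) / (k ! * 2 ^ k)  ≡⟨ m*n/n≡m (matchings k) (k ! * 2 ^ k) ⟩
  matchings k                                    ∎
  where
  open ≡-Reasoning
  instance
    _ = k !≢0
    _ = m^n≢0 2 k
    _ = m*n≢0 (k !) (2 ^ k)

involutionSum : ℕ → ℕ → ℕ
involutionSum N j = ∑[ k < N ] (matchings (toℕ k) * (j C (2 * toℕ k)))

matchings*C-suc-suc : ∀ j k → matchings (suc k) * (suc (suc j) C (2 * suc k))
  ≡ matchings (suc k) * (suc j C (2 * suc k)) + suc j * (matchings k * (j C (2 * k)))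
matchings*C-suc-suc j k = begin
  m′ * (suc (suc j) C (2 * suc k))          ≡⟨ cong (λ r → m′ * (suc (suc j) C r)) (2*[1+k]≡2+2*k k) ⟩
  m′ * (suc (suc j) C suc (suc (2 * k)))    ≡⟨ cong (m′ *_) (nCk+nC[k+1]≡[n+1]C[k+1] (suc j) (suc (2 * k))) ⟨
  m′ * (X + suc j C suc (suc (2 * k)))      ≡⟨ cong (λ r → m′ * (X + suc j C r)) (2*[1+k]≡2+2*k k) ⟨
  suc (2 * k) * m * (X + Y)                 ≡⟨ split (suc (2 * k)) m X Y ⟩
  m′ * Y + m * (suc (2 * k) * X)            ≡⟨ cong (λ r → m′ * Y + m * r) ([1+k]*[1+n]C[1+k]≡[1+n]*nCk j (2 * k)) ⟩
  m′ * Y + m * (suc j * (j C (2 * k)))      ≡⟨ cong (m′ * Y +_) (swap m (suc j) (j C (2 * k))) ⟩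
  m′ * Y + suc j * (m * (j C (2 * k)))      ∎
  where
  open ≡-Reasoning
  m = matchings k
  m′ = matchings (suc k)
  X = suc j C suc (2 * k)
  Y = suc j C (2 * suc k)
  split : ∀ a b x y → a * b * (x + y) ≡ a * b * y + b * (a * x)
  split = solve-∀
  swap : ∀ a b c → a * (b * c) ≡ b * (a * c)
  swap = solve-∀

involutionSum-suc-suc : ∀ N j →
  involutionSum (suc N) (suc (suc j)) ≡ involutionSum (suc N) (suc j) + suc j * involutionSum N j
involutionSum-suc-suc N j = begin
  1 + ∑[ k < N ] T (suc (suc j)) (suc (toℕ k))
    ≡⟨ cong (1 +_) (sum-cong-≗ {N} (λ k → matchings*C-suc-suc j (toℕ k))) ⟩
  1 + ∑[ k < N ] (T (suc j) (suc (toℕ k)) + suc j * T j (toℕ k))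
    ≡⟨ cong (1 +_) (∑-distrib-+ {N} (λ k → T (suc j) (suc (toℕ k))) (λ k → suc j * T j (toℕ k))) ⟩
  1 + (∑[ k < N ] T (suc j) (suc (toℕ k)) + ∑[ k < N ] (suc j * T j (toℕ k)))
    ≡⟨ cong (λ r → 1 + (∑[ k < N ] T (suc j) (suc (toℕ k)) + r)) (*-distribˡ-sum {N} (suc j) (T j ∘ toℕ)) ⟨
  1 + (∑[ k < N ] T (suc j) (suc (toℕ k)) + suc j * involutionSum N j)
    ≡⟨ +-assoc 1 (∑[ k < N ] T (suc j) (suc (toℕ k))) (suc j * involutionSum N j) ⟨
  involutionSum (suc N) (suc j) + suc j * involutionSum N j
    ∎
  where
  open ≡-Reasoning
  T : ℕ → ℕ → ℕ
  T j k = matchings k * (j C (2 * k))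

involutionSum-small : ∀ N j → j ≤ 1 → involutionSum (suc N) j ≡ 1
involutionSum-small N j j≤1 = cong suc (∑-zero {N} _ tail≡0)
  where
  tail≡0 : ∀ k → matchings (suc (toℕ k)) * (j C (2 * suc (toℕ k))) ≡ 0
  tail≡0 k = trans (cong (matchings (suc (toℕ k)) *_) (k>n⇒nCk≡0 j<2*[1+k])) (*-zeroʳ (matchings (suc (toℕ k))))
    where j<2*[1+k] = <-≤-trans (s≤s j≤1) (*-monoʳ-≤ 2 (s≤s z≤n))

involutionSum≡I₁ : ∀ N j → j ≤ 2 * N → involutionSum (suc N) j ≡ I₁ j
-- I₁ 0 and I₁ 1 evaluate to 1.
involutionSum≡I₁ N zero j≤2N = involutionSum-small N 0 z≤n
involutionSum≡I₁ N (suc zero) j≤2N = involutionSum-small N 1 (s≤s z≤n)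
involutionSum≡I₁ zero (suc (suc j)) ()
involutionSum≡I₁ (suc N) (suc (suc j)) j+2≤2N+2 = begin
  involutionSum (suc (suc N)) (suc (suc j))                    ≡⟨ involutionSum-suc-suc (suc N) j ⟩
  involutionSum (suc (suc N)) (suc j) + suc j * involutionSum (suc N) j
    ≡⟨ cong₂ (λ a b → a + suc j * b) (involutionSum≡I₁ (suc N) (suc j) (≤-trans (n≤1+n (suc j)) j+2≤2N+2))
                                       (involutionSum≡I₁ N j j≤2N) ⟩
  I₁ (suc j) + suc j * I₁ j                                    ≡⟨ I₁-suc-suc j ⟨
  I₁ (suc (suc j))                                             ∎
  where
  open ≡-Reasoning
  j≤2N : j ≤ 2 * N
  j≤2N = ≤-pred (≤-pred (subst (suc (suc j) ≤_) (2*[1+k]≡2+2*k N) j+2≤2N+2))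

∑matchings*C≡∑involutionSum : ∀ N n →
  ∑[ k < N ] (matchings (toℕ k) * (n C suc (2 * toℕ k))) ≡ ∑[ j < n ] involutionSum N (toℕ j)
∑matchings*C≡∑involutionSum N n = begin
  ∑[ k < N ] (matchings (toℕ k) * (n C suc (2 * toℕ k)))
    ≡⟨ sum-cong-≗ {N} (λ k → cong (matchings (toℕ k) *_) (nC[1+k]≡∑jCk n (2 * toℕ k))) ⟩
  ∑[ k < N ] (matchings (toℕ k) * ∑[ j < n ] (toℕ j C (2 * toℕ k)))
    ≡⟨ sum-cong-≗ {N} (λ k → *-distribˡ-sum {n} (matchings (toℕ k)) _) ⟩
  ∑[ k < N ] ∑[ j < n ] (matchings (toℕ k) * (toℕ j C (2 * toℕ k)))
    ≡⟨ ∑-comm {N} {n} (λ k j → matchings (toℕ k) * (toℕ j C (2 * toℕ k))) ⟩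
  ∑[ j < n ] involutionSum N (toℕ j)
    ∎
  where open ≡-Reasoning

mainTheorem11 : (n : ℕ) →
    sum (map (λ k → oddDoubleFact k * (suc n C suc (2 * k))) (upTo (suc n)))
      ≡ sum (map I₁ (upTo (suc n)))
mainTheorem11 n = begin
  sum (map (λ k → oddDoubleFact k * (suc n C suc (2 * k))) (upTo (suc n)))
    ≡⟨ sum-map-applyUpTo _ (λ k → k) (suc n) ⟩
  ∑[ k < suc n ] (oddDoubleFact (toℕ k) * (suc n C suc (2 * toℕ k)))
    ≡⟨ sum-cong-≗ {suc n} (λ k → cong (_* (suc n C suc (2 * toℕ k))) (oddDoubleFact≡matchings (toℕ k))) ⟩
  ∑[ k < suc n ] (matchings (toℕ k) * (suc n C suc (2 * toℕ k)))
    ≡⟨ ∑matchings*C≡∑involutionSum (suc n) (suc n) ⟩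
  ∑[ j < suc n ] involutionSum (suc n) (toℕ j)
    ≡⟨ sum-cong-≗ {suc n} (λ j → involutionSum≡I₁ n (toℕ j) (toℕ[j]≤2n j)) ⟩
  ∑[ j < suc n ] I₁ (toℕ j)
    ≡⟨ sum-map-applyUpTo I₁ (λ k → k) (suc n) ⟨
  sum (map I₁ (upTo (suc n)))
    ∎
  where
  open ≡-Reasoning
  toℕ[j]≤2n : (j : Fin (suc n)) → toℕ j ≤ 2 * n
  toℕ[j]≤2n j = ≤-trans (≤-pred (toℕ<n j)) (m≤m+n n (n + 0))
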